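{- Let $G\in\mathcal{G}$, with cliques on $X=\{x_1,\ldots,x_m\}$ and $Y=\{y_1,\ldots,y_n\}$, where $n\geq m+3$, such that $\{x_1,y_1\}$, $\{x_2,y_2\}$, $\{x_3,y_3\}$ are edges of $G$ and at most $n-m$ vertices of $Y$ have a neighbour in $X$. Then $T_2(G)$ is not well-covered.
   Context: $\mathcal{G}$ is the class of graphs obtained by taking the disjoint union of a complete graph $K_m$ with vertex set $X=\{x_1,\ldots,x_m\}$ and a complete graph $K_n$ with vertex set $Y=\{y_1,\ldots,y_n\}$, where $n\geq m$, and then adding some (possibly no) edges each joining a vertex of $X$ to a vertex of $Y$. The $2$-token graph $T_2(G)$ has as vertices the $2$-subsets of $V(G)$, two of them adjacent if their symmetric difference is an edge of $G$. A graph is well-covered if all of its maximal (with respect to inclusion) independent sets have the same cardinality. -}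

module Defs where

open import Data.Nat using (ℕ; _+_)
open import Data.Bool using (Bool; true)
open import Data.Fin using (Fin; splitAt; _<_)
open import Data.Sum using (_⊎_; inj₁; inj₂)
open import Data.Product using (Σ; _×_; _,_; proj₁; proj₂; ∃)
open import Data.List using (List; length; filterᵇ; allFin)
open import Data.Bool.ListAction using (any)
open import Data.List.Membership.Propositional using (_∈_)
open import Data.List.Relation.Unary.Unique.Propositional using (Unique)
open import Data.List.Relation.Binary.Subset.Propositional using (_⊆_)
open import Relation.Binary.PropositionalEquality using (_≡_; _≢_)
open import Relation.Nullary using (¬_)
open import Function.Bundles using (_⇔_)

Graph : ℕ → Set₁
Graph N = Fin N → Fin N → Set

-- The class 𝒢: vertices Fin (m + n); the first m are X = {x_1..x_m},
-- the last n are Y = {y_1..y_n}.  X and Y are cliques; the X–Y edges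
-- are given by an arbitrary Boolean relation E (E x y = true iff x ~ y).

GAdj : (m n : ℕ) → (Fin m → Fin n → Bool) → Graph (m + n)
GAdj m n E u v with splitAt m u | splitAt m v
... | inj₁ a | inj₁ b = a ≢ b
... | inj₂ a | inj₂ b = a ≢ b
... | inj₁ a | inj₂ b = E a b ≡ true
... | inj₂ a | inj₁ b = E b a ≡ true

numYWithXNbr : (m n : ℕ) → (Fin m → Fin n → Bool) → ℕ
numYWithXNbr m n E = length (filterᵇ (λ y → any (λ x → E x y) (allFin m)) (allFin n))

-- 2-token graph.  A 2-subset {i, j} of Fin N is represented uniquely
-- as an ordered pair (i , j) with i < j.

TwoSubset : ℕ → Set
TwoSubset N = Σ (Fin N × Fin N) (λ p → proj₁ p < proj₂ p)

_∈₂_ : ∀ {N} → Fin N → TwoSubset N → Set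
x ∈₂ ((i , j) , _) = x ≡ i ⊎ x ≡ j

_∈Δ_,_ : ∀ {N} → Fin N → TwoSubset N → TwoSubset N → Set
x ∈Δ A , B = (x ∈₂ A × ¬ (x ∈₂ B)) ⊎ (x ∈₂ B × ¬ (x ∈₂ A))

T2 : ∀ {N} → Graph N → TwoSubset N → TwoSubset N → Set
T2 {N} G A B =
  ∃ λ (u : Fin N) → ∃ λ (w : Fin N) →
    G u w × (∀ x → (x ∈Δ A , B) ⇔ (x ≡ u ⊎ x ≡ w))

-- Independent sets, maximality (w.r.t. inclusion), well-coveredness,
-- for a graph on an arbitrary vertex type; finite vertex sets are
-- represented as duplicate-free lists, cardinality = length.

Independent : {V : Set} → (V → V → Set) → List V → Set
Independent adj S = ∀ {a b} → a ∈ S → b ∈ S → ¬ adj a b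

MaximalIndependent : {V : Set} → (V → V → Set) → List V → Set
MaximalIndependent {V} adj S =
  Unique S × Independent adj S ×
  ((T : List V) → Independent adj T → S ⊆ T → T ⊆ S)

WellCovered : {V : Set} → (V → V → Set) → Set
WellCovered {V} adj =
  (S T : List V) → MaximalIndependent adj S → MaximalIndependent adj T →
  length S ≡ length T

-- Two pairs of an independent set of T₂(G) that share a vertex have non-adjacent other ends.
-- Hence in an independent set J the pairs inside X are disjoint, so are the pairs inside Y, and
-- the mixed pairs have distinct X-ends: |J| ≤ ⌊m/2⌋ + ⌊n/2⌋ + m.  At least m vertices of Y have
-- no neighbour in X; with them, blocks {xx′, xy, x′y′, yy′} (y, y′ isolated) followed by a
-- matching of the rest of Y attain the bound.  On the other side take the seed
-- I = {x₁y₂, x₂y₃, x₃y₁} plus a maximal matching of x₄, …, x_m.  Greedy completions of I and of the blocks are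
-- maximal independent sets of different sizes.

module Submission where

open import Defs
open import Data.Nat using (ℕ; zero; suc; _+_; _∸_; _≤_; _<_; z≤n; s≤s; ⌊_/2⌋)
open import Data.Nat.Properties
  using ( module ≤-Reasoning; ≤-trans; ≤-reflexive; <⇒≤; <-irrefl; +-suc; +-mono-≤; +-monoʳ-≤
        ; +-cancelʳ-≤; m+[n∸m]≡n; m<m+n; <-≤-trans; n≡⌊n+n/2⌋; ⌊n/2⌋-mono)
open import Data.Nat.ListAction using (sum)
open import Data.Nat.Tactic.RingSolver using (solve-∀)
open import Data.Bool using (Bool; true; false; not; T) renaming (_≟_ to _≟ᵇ_)
open import Data.Bool.Properties using (¬-not; T-not-≡; T-≡)
open import Data.Bool.ListAction using (any)
open import Data.Fin as Fin using (Fin; zero; suc; _↑ˡ_; _↑ʳ_; splitAt)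
open import Data.Fin.Patterns using (0F; 1F; 2F)
open import Data.Fin.Properties
  using ( <-cmp; <-irrelevant; <⇒≢; <-asym; _<?_; any?; all?; ↑ˡ-injective; ↑ʳ-injective
        ; splitAt-↑ˡ; splitAt-↑ʳ; splitAt⁻¹-↑ˡ; splitAt⁻¹-↑ʳ)
  renaming (_≟_ to _≟ᶠ_)
open import Data.Empty using (⊥; ⊥-elim)
open import Data.Unit using (⊤; tt)
open import Data.Sum using (_⊎_; inj₁; inj₂; [_,_]; swap)
open import Data.Product using (Σ; _×_; _,_; proj₁; proj₂)
open import Data.List using (List; []; _∷_; _++_; length; map; concatMap; allFin; filterᵇ)
open import Data.List.Properties using (length-++; length-map; length-tabulate)
open import Data.List.Relation.Unary.Any as Any using (Any; here; there)
open import Data.List.Relation.Unary.Any.Properties using (any⁺)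
open import Data.List.Relation.Unary.All as All using (All; []; _∷_)
open import Data.List.Relation.Unary.All.Properties.Core using (¬Any⇒All¬)
open import Data.List.Relation.Unary.AllPairs using ([]; _∷_)
open import Data.List.Relation.Unary.Unique.Propositional using (Unique)
import Data.List.Relation.Unary.Unique.Propositional.Properties as Unique
open import Data.List.Membership.Propositional using (_∈_; _∉_; find)
open import Data.List.Membership.Propositional.Properties
  using ( ∈-∃++; ∈-++⁻; ∈-++⁺ˡ; ∈-++⁺ʳ; ∈-allFin; ∈-map⁺; ∈-map⁻; ∈-filter⁻; ∈-concatMap⁺; ∈-concatMap⁻)
open import Data.List.Relation.Binary.Subset.Propositional using (_⊆_)
open import Function using (id; _∘_)
open import Function.Bundles using (_⇔_; mk⇔; Equivalence)
open import Relation.Binary using (tri<; tri≈; tri>)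
open import Relation.Binary.Definitions using (DecidableEquality; Decidable)
open import Relation.Binary.PropositionalEquality
  using (_≡_; _≢_; refl; sym; trans; cong; cong₂; subst; subst₂; ≢-sym; module ≡-Reasoning)
open import Relation.Nullary using (¬_; Dec; yes; no)
open import Relation.Nullary.Decidable using (_×-dec_; _⊎-dec_; _→-dec_; ¬?; T?; map′)

module _ {A : Set} where

  private
    ∈-++-∷⁻ : ∀ {z x : A} us {vs} → z ∈ us ++ x ∷ vs → z ≢ x → z ∈ us ++ vs
    ∈-++-∷⁻ us z∈ z≢x with ∈-++⁻ us z∈
    ... | inj₁ z∈us         = ∈-++⁺ˡ z∈us
    ... | inj₂ (here z≡x)   = ⊥-elim (z≢x z≡x)
    ... | inj₂ (there z∈vs) = ∈-++⁺ʳ us z∈vs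

    length-++-∷ : ∀ (us : List A) {x vs} → length (us ++ x ∷ vs) ≡ suc (length (us ++ vs))
    length-++-∷ us {x} {vs} = begin
      length (us ++ x ∷ vs)         ≡⟨ length-++ us ⟩
      length us + suc (length vs)   ≡⟨ +-suc (length us) (length vs) ⟩
      suc (length us + length vs)   ≡⟨ cong suc (length-++ us) ⟨
      suc (length (us ++ vs))       ∎
      where open ≡-Reasoning

  Unique-⊆⇒length≤ : ∀ {xs ys : List A} → Unique xs → xs ⊆ ys → length xs ≤ length ys
  Unique-⊆⇒length≤ {[]} _ _ = z≤n
  Unique-⊆⇒length≤ {x ∷ xs} (x∉xs ∷ uxs) xs⊆ys with us , vs , refl ← ∈-∃++ (xs⊆ys (here refl)) =
    ≤-trans (s≤s (Unique-⊆⇒length≤ uxs xs⊆us++vs)) (≤-reflexive (sym (length-++-∷ us)))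
    where
    xs⊆us++vs : xs ⊆ us ++ vs
    xs⊆us++vs z∈xs = ∈-++-∷⁻ us (xs⊆ys (there z∈xs)) λ { refl → All.lookup x∉xs z∈xs refl }

length-allFin : ∀ t → length (allFin t) ≡ t
length-allFin t = length-tabulate {n = t} (λ i → i)

Unique⇒length≤ : ∀ {t} {xs : List (Fin t)} → Unique xs → length xs ≤ t
Unique⇒length≤ {t} uxs = ≤-trans (Unique-⊆⇒length≤ uxs (λ {z} _ → ∈-allFin z)) (≤-reflexive (length-allFin t))

double≤⇒≤⌊/2⌋ : ∀ {a k} → a + a ≤ k → a ≤ ⌊ k /2⌋
double≤⇒≤⌊/2⌋ {a} a+a≤k = ≤-trans (≤-reflexive (n≡⌊n+n/2⌋ a)) (⌊n/2⌋-mono a+a≤k)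

IndependentSet : {V : Set} → (V → V → Set) → List V → Set
IndependentSet adj S = Unique S × Independent adj S

module Greedy {V : Set} (adj : V → V → Set)
  (adj-irrefl : ∀ {v} → ¬ adj v v) (adj-sym : ∀ {u v} → adj u v → adj v u)
  (_≟_ : DecidableEquality V) (adj? : Decidable adj)
  (vertices : List V) (∈-vertices : ∀ v → v ∈ vertices) where

  Blocked : V → V → Set
  Blocked v w = v ≡ w ⊎ adj v w

  blocked? : ∀ v S → Dec (Any (Blocked v) S)
  blocked? v = Any.any? λ w → (v ≟ w) ⊎-dec adj? v w

  extendBy : List V → List V → List V
  extendBy S [] = S
  extendBy S (v ∷ vs) with blocked? v S
  ... | yes _ = extendBy S vs
  ... | no _  = extendBy (v ∷ S) vs

  ⊆-extendBy : ∀ S vs → S ⊆ extendBy S vs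
  ⊆-extendBy S [] v∈S = v∈S
  ⊆-extendBy S (v ∷ vs) w∈S with blocked? v S
  ... | yes _ = ⊆-extendBy S vs w∈S
  ... | no _  = ⊆-extendBy (v ∷ S) vs (there w∈S)

  extendBy-independent : ∀ S vs → IndependentSet adj S → IndependentSet adj (extendBy S vs)
  extendBy-independent S [] indS = indS
  extendBy-independent S (v ∷ vs) (uS , iS) with blocked? v S
  ... | yes _ = extendBy-independent S vs (uS , iS)
  ... | no unblocked = extendBy-independent (v ∷ S) vs (All.map proj₁ free ∷ uS , iv∷S)
    where
    free : All (λ w → v ≢ w × ¬ adj v w) S
    free = All.map (λ nb → (λ e → nb (inj₁ e)) , (λ a → nb (inj₂ a))) (¬Any⇒All¬ S unblocked)
    iv∷S : Independent adj (v ∷ S)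
    iv∷S (here refl) (here refl) = adj-irrefl
    iv∷S (here refl) (there b)   = proj₂ (All.lookup free b)
    iv∷S (there a)   (here refl) = λ a~v → proj₂ (All.lookup free a) (adj-sym a~v)
    iv∷S (there a)   (there b)   = iS a b

  extendBy-covers : ∀ S vs {v} → v ∈ vs → Σ V λ w → w ∈ extendBy S vs × Blocked v w
  extendBy-covers S (v ∷ vs) v∈ with blocked? v S
  extendBy-covers S (v ∷ vs) (here refl) | yes blocked with w , w∈S , b ← find blocked =
    w , ⊆-extendBy S vs w∈S , b
  extendBy-covers S (v ∷ vs) (here refl) | no _ = v , ⊆-extendBy (v ∷ S) vs (here refl) , inj₁ refl
  extendBy-covers S (v ∷ vs) (there u∈)  | yes _ = extendBy-covers S vs u∈
  extendBy-covers S (v ∷ vs) (there u∈)  | no _  = extendBy-covers (v ∷ S) vs u∈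

  complete : List V → List V
  complete S = extendBy S vertices

  complete-maximal : ∀ {S} → IndependentSet adj S → MaximalIndependent adj (complete S)
  complete-maximal {S} indS = proj₁ ind , proj₂ ind , maximal
    where
    ind : IndependentSet adj (complete S)
    ind = extendBy-independent S vertices indS
    maximal : (T : List V) → Independent adj T → complete S ⊆ T → T ⊆ complete S
    maximal T iT sub {t} t∈T with extendBy-covers S vertices (∈-vertices t)
    ... | w , w∈ , inj₁ refl = w∈
    ... | w , w∈ , inj₂ t~w  = ⊥-elim (iT t∈T (sub w∈) t~w)

  smallExtensions⇒¬WellCovered : ∀ {I B} → IndependentSet adj I → IndependentSet adj B →
    (∀ {J} → IndependentSet adj J → I ⊆ J → length J < length B) → ¬ WellCovered adj
  smallExtensions⇒¬WellCovered {I} {B} indI indB small wc = <-irrefl refl (begin-strict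
    length (complete I) <⟨ small (extendBy-independent I vertices indI) (⊆-extendBy I vertices) ⟩
    length B            ≤⟨ Unique-⊆⇒length≤ (proj₁ indB) (⊆-extendBy B vertices) ⟩
    length (complete B) ≡⟨ sym (wc _ _ (complete-maximal indI) (complete-maximal indB)) ⟩
    length (complete I) ∎)
    where open ≤-Reasoning

length-concatMap-double : {B A : Set} (f : B → List A) (g : B → ℕ) → (∀ b → length (f b) ≡ g b + g b) →
                          ∀ bs → length (concatMap f bs) ≡ sum (map g bs) + sum (map g bs)
length-concatMap-double f g fg [] = refl
length-concatMap-double f g fg (b ∷ bs) = begin
  length (f b ++ concatMap f bs)                 ≡⟨ length-++ (f b) ⟩
  length (f b) + length (concatMap f bs)         ≡⟨ cong₂ _+_ (fg b) (length-concatMap-double f g fg bs) ⟩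
  (g b + g b) + (sum (map g bs) + sum (map g bs)) ≡⟨ interchange (g b) (sum (map g bs)) ⟩
  (g b + sum (map g bs)) + (g b + sum (map g bs)) ∎
  where
  open ≡-Reasoning
  interchange : ∀ x y → (x + x) + (y + y) ≡ (x + y) + (x + y)
  interchange = solve-∀

length-filterᵇ-partition : {A : Set} (p : A → Bool) (xs : List A) →
                          length (filterᵇ (not ∘ p) xs) + length (filterᵇ p xs) ≡ length xs
length-filterᵇ-partition p [] = refl
length-filterᵇ-partition p (x ∷ xs) with p x
... | true  = trans (+-suc _ _) (cong suc (length-filterᵇ-partition p xs))
... | false = cong suc (length-filterᵇ-partition p xs)

module _ {t : ℕ} {L : List (Fin t)} (uL : Unique L) where

  open import Data.List.Membership.DecPropositional (_≟ᶠ_ {t}) using (_∈?_)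

  two-absent⇒2+length≤ : ∀ {p q} → p ≢ q → p ∉ L → q ∉ L → 2 + length L ≤ t
  two-absent⇒2+length≤ p≢q p∉L q∉L = Unique⇒length≤ ((p≢q ∷ ¬Any⇒All¬ L p∉L) ∷ ¬Any⇒All¬ L q∉L ∷ uL)

  at-most-one-of-three⇒2+length≤ : ∀ {p q r} → p ≢ q → p ≢ r → q ≢ r →
    (p ∈ L → q ∈ L → ⊥) → (p ∈ L → r ∈ L → ⊥) → (q ∈ L → r ∈ L → ⊥) → 2 + length L ≤ t
  at-most-one-of-three⇒2+length≤ {p} {q} {r} p≢q p≢r q≢r ¬pq ¬pr ¬qr with p ∈? L | q ∈? L
  ... | yes p∈L | _       = two-absent⇒2+length≤ q≢r (¬pq p∈L) (¬pr p∈L)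
  ... | no p∉L  | yes q∈L = two-absent⇒2+length≤ p≢r p∉L (¬qr q∈L)
  ... | no p∉L  | no q∉L  = two-absent⇒2+length≤ p≢q p∉L q∉L

module TokenGraph {N : ℕ} (G : Graph N)
  (G-irrefl : ∀ {u} → ¬ G u u) (G-sym : ∀ {u v} → G u v → G v u) where

  Pair : Set
  Pair = TwoSubset N

  record Spans (P : Pair) (u v : Fin N) : Set where
    field
      ⊆uv : ∀ x → x ∈₂ P → x ≡ u ⊎ x ≡ v
      u∈  : u ∈₂ P
      v∈  : v ∈₂ P
      u≢v : u ≢ v

  open Spans

  Spans-sym : ∀ {P u v} → Spans P u v → Spans P v u
  Spans-sym s = record { ⊆uv = λ x x∈ → swap (⊆uv s x x∈) ; u∈ = v∈ s ; v∈ = u∈ s ; u≢v = ≢-sym (u≢v s) }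

  Spans-all : ∀ {P u v} (Q : Fin N → Set) → Spans P u v → Q u → Q v → ∀ {x} → x ∈₂ P → Q x
  Spans-all Q s Qu Qv {x} x∈P with ⊆uv s x x∈P
  ... | inj₁ refl = Qu
  ... | inj₂ refl = Qv

  ≡-Pair : ∀ {i j i′ j′} {i<j : i Fin.< j} {i′<j′ : i′ Fin.< j′} → i ≡ i′ → j ≡ j′ →
           _≡_ {A = Pair} ((i , j) , i<j) ((i′ , j′) , i′<j′)
  ≡-Pair {i<j = i<j} {i′<j′} refl refl = cong ((_ , _) ,_) (<-irrelevant i<j i′<j′)

  ⊆⇒≡ : ∀ {P Q : Pair} → (∀ x → x ∈₂ P → x ∈₂ Q) → P ≡ Q
  ⊆⇒≡ {(i , j) , i<j} {(i′ , j′) , i′<j′} P⊆Q with P⊆Q i (inj₁ refl) | P⊆Q j (inj₂ refl)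
  ... | inj₁ i≡i′ | inj₂ j≡j′ = ≡-Pair i≡i′ j≡j′
  ... | inj₁ i≡i′ | inj₁ j≡i′ = ⊥-elim (<⇒≢ i<j (trans i≡i′ (sym j≡i′)))
  ... | inj₂ i≡j′ | inj₂ j≡j′ = ⊥-elim (<⇒≢ i<j (trans i≡j′ (sym j≡j′)))
  ... | inj₂ i≡j′ | inj₁ j≡i′ = ⊥-elim (<-asym i<j (subst₂ Fin._<_ (sym j≡i′) (sym i≡j′) i′<j′))

  Spans-unique : ∀ {P Q u v} → Spans P u v → Spans Q u v → P ≡ Q
  Spans-unique sP sQ = ⊆⇒≡ λ x x∈P → [ (λ { refl → u∈ sQ }) , (λ { refl → v∈ sQ }) ] (⊆uv sP x x∈P)

  ordered-spans : ∀ {i j} (i<j : i Fin.< j) → Spans ((i , j) , i<j) i j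
  ordered-spans i<j = record { ⊆uv = λ _ x∈ → x∈ ; u∈ = inj₁ refl ; v∈ = inj₂ refl ; u≢v = <⇒≢ i<j }

  pair : (u v : Fin N) → u ≢ v → Pair
  pair u v u≢v with <-cmp u v
  ... | tri< u<v _ _ = (u , v) , u<v
  ... | tri≈ _ u≡v _ = ⊥-elim (u≢v u≡v)
  ... | tri> _ _ v<u = (v , u) , v<u

  pair-spans : ∀ {u v} (u≢v : u ≢ v) → Spans (pair u v u≢v) u v
  pair-spans {u} {v} u≢v with <-cmp u v
  ... | tri< u<v _ _ = ordered-spans u<v
  ... | tri≈ _ u≡v _ = ⊥-elim (u≢v u≡v)
  ... | tri> _ _ v<u = Spans-sym (ordered-spans v<u)

  Disjoint : Pair → Pair → Set
  Disjoint P Q = ∀ x → x ∈₂ P → ¬ x ∈₂ Q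

  Spans-disjoint : ∀ {P Q a b c d} → Spans P a b → Spans Q c d →
                   a ≢ c → a ≢ d → b ≢ c → b ≢ d → Disjoint P Q
  Spans-disjoint sP sQ a≢c a≢d b≢c b≢d x x∈P x∈Q with ⊆uv sP x x∈P | ⊆uv sQ x x∈Q
  ... | inj₁ refl | inj₁ x≡c = a≢c x≡c
  ... | inj₁ refl | inj₂ x≡d = a≢d x≡d
  ... | inj₂ refl | inj₁ x≡c = b≢c x≡c
  ... | inj₂ refl | inj₂ x≡d = b≢d x≡d

  T2-sym : ∀ {P Q} → T2 G P Q → T2 G Q P
  T2-sym (u , w , u~w , eq) =
    u , w , u~w , λ x → mk⇔ (λ x∈ → Equivalence.to (eq x) (swap x∈)) (λ e → swap (Equivalence.from (eq x) e))

  ¬T2-refl : ∀ {P} → ¬ T2 G P P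
  ¬T2-refl (u , w , u~w , eq) with Equivalence.from (eq u) (inj₁ refl)
  ... | inj₁ (u∈ , u∉) = u∉ u∈
  ... | inj₂ (u∈ , u∉) = u∉ u∈

  private
    third-endpoint : ∀ {a b c u w : Fin N} → a ≢ b →
                     a ≡ u ⊎ a ≡ w → b ≡ u ⊎ b ≡ w → c ≡ u ⊎ c ≡ w → c ≡ a ⊎ c ≡ b
    third-endpoint a≢b (inj₁ refl) (inj₁ refl) _ = ⊥-elim (a≢b refl)
    third-endpoint a≢b (inj₂ refl) (inj₂ refl) _ = ⊥-elim (a≢b refl)
    third-endpoint a≢b (inj₁ refl) (inj₂ refl) c∈ = c∈
    third-endpoint a≢b (inj₂ refl) (inj₁ refl) c∈ = swap c∈

  ¬T2-disjoint : ∀ {P Q} → Disjoint P Q → ¬ T2 G P Q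
  ¬T2-disjoint {P@((a₁ , a₂) , a₁<a₂)} {Q@((b₁ , _) , _)} P∩Q=∅ (u , w , _ , eq) =
    P∩Q=∅ b₁ (third-endpoint (<⇒≢ a₁<a₂) (on-edge a₁ (inj₁ (inj₁ refl , P∩Q=∅ a₁ (inj₁ refl))))
                                         (on-edge a₂ (inj₁ (inj₂ refl , P∩Q=∅ a₂ (inj₂ refl))))
                                         (on-edge b₁ (inj₂ (inj₁ refl , λ b₁∈P → P∩Q=∅ b₁ b₁∈P (inj₁ refl)))))
             (inj₁ refl)
    where
    on-edge : ∀ x → x ∈Δ P , Q → x ≡ u ⊎ x ≡ w
    on-edge x = Equivalence.to (eq x)

  private
    Δ-meeting : ∀ {P Q c p q x} → Spans P c p → Spans Q c q → x ∈Δ P , Q → x ≡ p ⊎ x ≡ q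
    Δ-meeting {x = x} sP sQ (inj₁ (x∈P , x∉Q)) with ⊆uv sP x x∈P
    ... | inj₁ refl = ⊥-elim (x∉Q (u∈ sQ))
    ... | inj₂ x≡p  = inj₁ x≡p
    Δ-meeting {x = x} sP sQ (inj₂ (x∈Q , x∉P)) with ⊆uv sQ x x∈Q
    ... | inj₁ refl = ⊥-elim (x∉P (u∈ sP))
    ... | inj₂ x≡q  = inj₂ x≡q

  -- {c, p} Δ {c, q} = {p, q}
  T2-meeting : ∀ {P Q c p q} → Spans P c p → Spans Q c q → G p q → T2 G P Q
  T2-meeting {P} {Q} {c} {p} {q} sP sQ p~q = p , q , p~q , λ x → mk⇔ (Δ-meeting sP sQ) (in-Δ x)
    where
    p≢q : p ≢ q
    p≢q refl = G-irrefl p~q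
    in-Δ : ∀ x → x ≡ p ⊎ x ≡ q → x ∈Δ P , Q
    in-Δ x (inj₁ refl) = inj₁ (v∈ sP , λ x∈Q → [ ≢-sym (u≢v sP) , p≢q ] (⊆uv sQ x x∈Q))
    in-Δ x (inj₂ refl) = inj₂ (v∈ sQ , λ x∈P → [ ≢-sym (u≢v sQ) , ≢-sym p≢q ] (⊆uv sP x x∈P))

  ¬T2-meeting : ∀ {P Q c p q} → Spans P c p → Spans Q c q → ¬ G p q → ¬ T2 G P Q
  ¬T2-meeting sP sQ p≁q (u , w , u~w , eq)
    with Δ-meeting sP sQ (Equivalence.from (eq u) (inj₁ refl))
       | Δ-meeting sP sQ (Equivalence.from (eq w) (inj₂ refl))
  ... | inj₁ refl | inj₁ refl = G-irrefl u~w
  ... | inj₁ refl | inj₂ refl = p≁q u~w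
  ... | inj₂ refl | inj₁ refl = p≁q (G-sym u~w)
  ... | inj₂ refl | inj₂ refl = G-irrefl u~w

  Compatible : Pair → Pair → Set
  Compatible P Q = P ≢ Q × ¬ T2 G P Q

  Disjoint⇒Compatible : ∀ {P Q} → Disjoint P Q → Compatible P Q
  Disjoint⇒Compatible {P@((i , _) , _)} {Q} P∩Q=∅ =
    (λ { refl → P∩Q=∅ i (inj₁ refl) (inj₁ refl) }) , ¬T2-disjoint {P} {Q} P∩Q=∅

  meeting-compatible : ∀ {P Q c p q} → Spans P c p → Spans Q c q → p ≢ q → ¬ G p q → Compatible P Q
  meeting-compatible sP sQ p≢q p≁q =
    (λ { refl → [ ≢-sym (u≢v sP) , p≢q ] (⊆uv sQ _ (v∈ sP)) }) , ¬T2-meeting sP sQ p≁q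

  IndependentSet-[] : IndependentSet (T2 G) []
  IndependentSet-[] = [] , λ ()

  IndependentSet-∷ : ∀ {P S} → IndependentSet (T2 G) S → (∀ {Q} → Q ∈ S → Compatible P Q) →
                     IndependentSet (T2 G) (P ∷ S)
  IndependentSet-∷ {P} {S} (uS , iS) compatible = All.tabulate (λ Q∈ → proj₁ (compatible Q∈)) ∷ uS , iP∷S
    where
    iP∷S : Independent (T2 G) (P ∷ S)
    iP∷S (here refl) (here refl) = ¬T2-refl {P}
    iP∷S (here refl) (there Q∈)  = proj₂ (compatible Q∈)
    iP∷S {Q} (there Q∈) (here refl) = λ Q~P → proj₂ (compatible Q∈) (T2-sym {Q} {P} Q~P)
    iP∷S (there Q∈)  (there R∈)  = iS Q∈ R∈

  IndependentSet-++ : ∀ {S T} → IndependentSet (T2 G) S → IndependentSet (T2 G) T →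
                      (∀ {P Q} → P ∈ S → Q ∈ T → Disjoint P Q) → IndependentSet (T2 G) (S ++ T)
  IndependentSet-++ {S} {T} (uS , iS) (uT , iT) S∩T=∅ =
    Unique.++⁺ uS uT (λ {P} (P∈S , P∈T) → proj₁ (Disjoint⇒Compatible {P} {P} (S∩T=∅ P∈S P∈T)) refl) , iS++T
    where
    iS++T : Independent (T2 G) (S ++ T)
    iS++T {P} {Q} P∈ Q∈ with ∈-++⁻ S P∈ | ∈-++⁻ S Q∈
    ... | inj₁ P∈S | inj₁ Q∈S = iS P∈S Q∈S
    ... | inj₂ P∈T | inj₂ Q∈T = iT P∈T Q∈T
    ... | inj₁ P∈S | inj₂ Q∈T = ¬T2-disjoint {P} {Q} (S∩T=∅ P∈S Q∈T)
    ... | inj₂ P∈T | inj₁ Q∈S = λ P~Q → ¬T2-disjoint {Q} {P} (S∩T=∅ Q∈S P∈T) (T2-sym {P} {Q} P~Q)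

  meeting-nonadjacent : ∀ {J P Q c p q} → Independent (T2 G) J → P ∈ J → Q ∈ J →
                        Spans P c p → Spans Q c q → ¬ G p q
  meeting-nonadjacent iJ P∈ Q∈ sP sQ p~q = iJ P∈ Q∈ (T2-meeting sP sQ p~q)

  -- A repeated end would be shared by two pairs of J whose other ends are adjacent in K.
  Unique-concatMap-ends : {A : Set} (ends : Pair → List A) (vertex : A → Fin N) (K : Fin N → Set) →
    (∀ {u v} → K u → K v → u ≢ v → G u v) →
    (∀ P {a} → a ∈ ends P → Σ (Fin N) λ v → Spans P (vertex a) v × K v) →
    (∀ P → Unique (ends P)) →
    ∀ {J} → IndependentSet (T2 G) J → Unique (concatMap ends J)
  Unique-concatMap-ends ends vertex K K-clique spec uEnds {[]} _ = []
  Unique-concatMap-ends ends vertex K K-clique spec uEnds {P ∷ J} (P∉J ∷ uJ , iP∷J) =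
    Unique.++⁺ (uEnds P) (Unique-concatMap-ends ends vertex K K-clique spec uEnds (uJ , iJ)) shared
    where
    iJ : Independent (T2 G) J
    iJ Q∈ R∈ = iP∷J (there Q∈) (there R∈)
    shared : ∀ {a} → ¬ (a ∈ ends P × a ∈ concatMap ends J)
    shared (a∈P , a∈J) with Q , Q∈J , a∈Q ← find (∈-concatMap⁻ ends a∈J)
                        with v , sP , Kv ← spec P a∈P | w , sQ , Kw ← spec Q a∈Q | v ≟ᶠ w
    ... | yes refl = All.lookup P∉J Q∈J (Spans-unique sP sQ)
    ... | no v≢w   = meeting-nonadjacent iP∷J (here refl) (there Q∈J) sP sQ (K-clique Kv Kw v≢w)

  pairUp : (L : List (Fin N)) → Unique L → List Pair
  pairUp []          _ = []
  pairUp (_ ∷ [])    _ = []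
  pairUp (u ∷ v ∷ L) ((u≢v ∷ _) ∷ _ ∷ uL) = pair u v u≢v ∷ pairUp L uL

  length-pairUp : ∀ L uL → length (pairUp L uL) ≡ ⌊ length L /2⌋
  length-pairUp []          _ = refl
  length-pairUp (_ ∷ [])    _ = refl
  length-pairUp (u ∷ v ∷ L) ((_ ∷ _) ∷ _ ∷ uL) = cong suc (length-pairUp L uL)

  pairUp-⊆ : ∀ L uL {P x} → P ∈ pairUp L uL → x ∈₂ P → x ∈ L
  pairUp-⊆ (u ∷ v ∷ L) ((u≢v ∷ _) ∷ _ ∷ uL) (here refl) x∈P with ⊆uv (pair-spans u≢v) _ x∈P
  ... | inj₁ refl = here refl
  ... | inj₂ refl = there (here refl)
  pairUp-⊆ (u ∷ v ∷ L) ((_ ∷ _) ∷ _ ∷ uL) (there P∈) x∈P = there (there (pairUp-⊆ L uL P∈ x∈P))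

  pairUp-independent : ∀ L uL → IndependentSet (T2 G) (pairUp L uL)
  pairUp-independent []          _ = IndependentSet-[]
  pairUp-independent (_ ∷ [])    _ = IndependentSet-[]
  pairUp-independent (u ∷ v ∷ L) ((u≢v ∷ u∉L) ∷ v∉L ∷ uL) =
    IndependentSet-∷ (pairUp-independent L uL) λ Q∈ → Disjoint⇒Compatible λ x x∈P x∈Q →
      [ (λ { refl → All.lookup u∉L (pairUp-⊆ L uL Q∈ x∈Q) refl })
      , (λ { refl → All.lookup v∉L (pairUp-⊆ L uL Q∈ x∈Q) refl }) ] (⊆uv (pair-spans u≢v) x x∈P)

  MatchedIn : (L : List (Fin N)) → Unique L → Fin N → Set
  MatchedIn L uL u = Σ Pair λ Q → Q ∈ pairUp L uL × Σ (Fin N) λ w → w ∈ L × Spans Q u w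

  pairUp-matches : ∀ L uL {u v} → u ∈ L → v ∈ L → u ≢ v → MatchedIn L uL u ⊎ MatchedIn L uL v
  pairUp-matches (_ ∷ []) _ (here refl) (here refl) u≢v = ⊥-elim (u≢v refl)
  pairUp-matches (a ∷ b ∷ L) ((a≢b ∷ _) ∷ _ ∷ uL) (here refl) _ _ =
    inj₁ (_ , here refl , b , there (here refl) , pair-spans a≢b)
  pairUp-matches (a ∷ b ∷ L) ((a≢b ∷ _) ∷ _ ∷ uL) (there (here refl)) _ _ =
    inj₁ (_ , here refl , a , here refl , Spans-sym (pair-spans a≢b))
  pairUp-matches (a ∷ b ∷ L) ((a≢b ∷ _) ∷ _ ∷ uL) (there (there _)) (here refl) _ =
    inj₂ (_ , here refl , b , there (here refl) , pair-spans a≢b)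
  pairUp-matches (a ∷ b ∷ L) ((a≢b ∷ _) ∷ _ ∷ uL) (there (there _)) (there (here refl)) _ =
    inj₂ (_ , here refl , a , here refl , Spans-sym (pair-spans a≢b))
  pairUp-matches (a ∷ b ∷ L) ((_ ∷ _) ∷ _ ∷ uL) (there (there u∈L)) (there (there v∈L)) u≢v
    with pairUp-matches L uL u∈L v∈L u≢v
  ... | inj₁ (Q , Q∈ , w , w∈ , sQ) = inj₁ (Q , there Q∈ , w , there (there w∈) , sQ)
  ... | inj₂ (Q , Q∈ , w , w∈ , sQ) = inj₂ (Q , there Q∈ , w , there (there w∈) , sQ)

  _≟ₚ_ : DecidableEquality Pair
  ((i , j) , _) ≟ₚ ((i′ , j′) , _) =
    map′ (λ (i≡i′ , j≡j′) → ≡-Pair i≡i′ j≡j′) (λ { refl → refl , refl }) ((i ≟ᶠ i′) ×-dec (j ≟ᶠ j′))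

  private
    _∈₂?_ : ∀ x (P : Pair) → Dec (x ∈₂ P)
    x ∈₂? ((i , j) , _) = (x ≟ᶠ i) ⊎-dec (x ≟ᶠ j)

    _⇔?_ : ∀ {A B : Set} → Dec A → Dec B → Dec (A ⇔ B)
    A? ⇔? B? = map′ (λ (f , g) → mk⇔ f g) (λ e → Equivalence.to e , Equivalence.from e)
                    ((A? →-dec B?) ×-dec (B? →-dec A?))

    ordered : Fin N → Fin N → List Pair
    ordered i j with i <? j
    ... | yes i<j = ((i , j) , i<j) ∷ []
    ... | no _    = []

    ∈-ordered : ∀ i j (i<j : i Fin.< j) → ((i , j) , i<j) ∈ ordered i j
    ∈-ordered i j i<j with i <? j
    ... | yes _   = here (≡-Pair refl refl)
    ... | no i≮j  = ⊥-elim (i≮j i<j)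

  T2? : Decidable G → Decidable (T2 G)
  T2? G? P Q = any? λ u → any? λ w → G? u w ×-dec all? λ x →
    (((x ∈₂? P) ×-dec ¬? (x ∈₂? Q)) ⊎-dec ((x ∈₂? Q) ×-dec ¬? (x ∈₂? P))) ⇔? ((x ≟ᶠ u) ⊎-dec (x ≟ᶠ w))

  pairs : List Pair
  pairs = concatMap (λ i → concatMap (ordered i) (allFin N)) (allFin N)

  ∈-pairs : ∀ P → P ∈ pairs
  ∈-pairs ((i , j) , i<j) =
    ∈-concatMap⁺ (λ i → concatMap (ordered i) (allFin N))
      (Any.map (λ { refl → ∈-concatMap⁺ (ordered i) (Any.map (λ { refl → ∈-ordered i j i<j }) (∈-allFin j)) })
               (∈-allFin i))

  smallExtensions⇒¬WellCovered-T2 : Decidable G → ∀ {I B} →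
    IndependentSet (T2 G) I → IndependentSet (T2 G) B →
    (∀ {J} → IndependentSet (T2 G) J → I ⊆ J → length J < length B) → ¬ WellCovered (T2 G)
  smallExtensions⇒¬WellCovered-T2 G? =
    Greedy.smallExtensions⇒¬WellCovered (T2 G) (λ {P} → ¬T2-refl {P}) (λ {P} {Q} → T2-sym {P} {Q})
      _≟ₚ_ (T2? G?) pairs ∈-pairs

module ClassG (m n : ℕ) (E : Fin m → Fin n → Bool) where

  G : Graph (m + n)
  G = GAdj m n E

  inX : Fin m → Fin (m + n)
  inX a = a ↑ˡ n

  inY : Fin n → Fin (m + n)
  inY c = m ↑ʳ c

  inX-injective : ∀ {a b} → inX a ≡ inX b → a ≡ b
  inX-injective = ↑ˡ-injective n _ _

  inY-injective : ∀ {c d} → inY c ≡ inY d → c ≡ d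
  inY-injective = ↑ʳ-injective m _ _

  inX≢ : ∀ {a b} → a ≢ b → inX a ≢ inX b
  inX≢ a≢b e = a≢b (inX-injective e)

  inY≢ : ∀ {c d} → c ≢ d → inY c ≢ inY d
  inY≢ c≢d e = c≢d (inY-injective e)

  inX≢inY : ∀ {a c} → inX a ≢ inY c
  inX≢inY {a} {c} x≡y
    with () ← trans (sym (splitAt-↑ˡ m a n)) (trans (cong (splitAt m) x≡y) (splitAt-↑ʳ m n c))

  data Side : Fin (m + n) → Set where
    isX : ∀ a → Side (inX a)
    isY : ∀ c → Side (inY c)

  side : ∀ u → Side u
  side u with splitAt m u in split-u
  ... | inj₁ a = subst Side (splitAt⁻¹-↑ˡ split-u) (isX a)
  ... | inj₂ c = subst Side (splitAt⁻¹-↑ʳ split-u) (isY c)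

  G-irrefl : ∀ {u} → ¬ G u u
  G-irrefl {u} with splitAt m u
  ... | inj₁ _ = λ a≢a → a≢a refl
  ... | inj₂ _ = λ c≢c → c≢c refl

  G-sym : ∀ {u v} → G u v → G v u
  G-sym {u} {v} with splitAt m u | splitAt m v
  ... | inj₁ _ | inj₁ _ = ≢-sym
  ... | inj₂ _ | inj₂ _ = ≢-sym
  ... | inj₁ _ | inj₂ _ = id
  ... | inj₂ _ | inj₁ _ = id

  G? : Decidable G
  G? u v with splitAt m u | splitAt m v
  ... | inj₁ a | inj₁ b = ¬? (a ≟ᶠ b)
  ... | inj₂ c | inj₂ d = ¬? (c ≟ᶠ d)
  ... | inj₁ a | inj₂ c = E a c ≟ᵇ true
  ... | inj₂ c | inj₁ a = E a c ≟ᵇ true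

  X-clique : ∀ {a b} → a ≢ b → G (inX a) (inX b)
  X-clique {a} {b} rewrite splitAt-↑ˡ m a n | splitAt-↑ˡ m b n = id

  Y-clique : ∀ {c d} → c ≢ d → G (inY c) (inY d)
  Y-clique {c} {d} rewrite splitAt-↑ʳ m n c | splitAt-↑ʳ m n d = id

  XY-edge : ∀ {a c} → E a c ≡ true → G (inX a) (inY c)
  XY-edge {a} {c} rewrite splitAt-↑ˡ m a n | splitAt-↑ʳ m n c = id

  Isolated : Fin n → Set
  Isolated c = ∀ a → E a c ≡ false

  isolated-nonadjacent : ∀ {a c} → Isolated c → ¬ G (inX a) (inY c)
  isolated-nonadjacent {a} {c} c-isolated rewrite splitAt-↑ˡ m a n | splitAt-↑ʳ m n c | c-isolated a = λ ()

  open TokenGraph G G-irrefl G-sym public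

  data Shape (P : Pair) : Set where
    XX : (a b : Fin m) → Spans P (inX a) (inX b) → Shape P
    YY : (c d : Fin n) → Spans P (inY c) (inY d) → Shape P
    XY : (a : Fin m) (c : Fin n) → Spans P (inX a) (inY c) → Shape P

  shape : (P : Pair) → Shape P
  shape ((i , j) , i<j) with side i | side j
  ... | isX a | isX b = XX a b (ordered-spans i<j)
  ... | isY c | isY d = YY c d (ordered-spans i<j)
  ... | isX a | isY c = XY a c (ordered-spans i<j)
  ... | isY c | isX a = XY a c (Spans-sym (ordered-spans i<j))

  InX InY : Fin (m + n) → Set
  InX v = Σ (Fin m) λ b → v ≡ inX b
  InY v = Σ (Fin n) λ d → v ≡ inY d

  InX-clique : ∀ {u v} → InX u → InX v → u ≢ v → G u v
  InX-clique (a , refl) (b , refl) u≢v = X-clique λ { refl → u≢v refl }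

  InY-clique : ∀ {u v} → InY u → InY v → u ≢ v → G u v
  InY-clique (c , refl) (d , refl) u≢v = Y-clique λ { refl → u≢v refl }

  xxEnds : Pair → List (Fin m)
  xxEnds P with shape P
  ... | XX a b _ = a ∷ b ∷ []
  ... | YY _ _ _ = []
  ... | XY _ _ _ = []

  yyEnds : Pair → List (Fin n)
  yyEnds P with shape P
  ... | XX _ _ _ = []
  ... | YY c d _ = c ∷ d ∷ []
  ... | XY _ _ _ = []

  xyEnd : Pair → List (Fin m)
  xyEnd P with shape P
  ... | XX _ _ _ = []
  ... | YY _ _ _ = []
  ... | XY a _ _ = a ∷ []

  #XX #YY : Pair → ℕ
  #XX P with shape P
  ... | XX _ _ _ = 1
  ... | YY _ _ _ = 0
  ... | XY _ _ _ = 0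
  #YY P with shape P
  ... | XX _ _ _ = 0
  ... | YY _ _ _ = 1
  ... | XY _ _ _ = 0

  xxEnds-spans : ∀ P {a} → a ∈ xxEnds P → Σ (Fin (m + n)) λ v → Spans P (inX a) v × InX v
  xxEnds-spans P a∈ with shape P
  xxEnds-spans P (here refl)         | XX a b sP = inX b , sP , b , refl
  xxEnds-spans P (there (here refl)) | XX a b sP = inX a , Spans-sym sP , a , refl

  yyEnds-spans : ∀ P {c} → c ∈ yyEnds P → Σ (Fin (m + n)) λ v → Spans P (inY c) v × InY v
  yyEnds-spans P c∈ with shape P
  yyEnds-spans P (here refl)         | YY c d sP = inY d , sP , d , refl
  yyEnds-spans P (there (here refl)) | YY c d sP = inY c , Spans-sym sP , c , refl

  xyEnd-spans : ∀ P {a} → a ∈ xyEnd P → Σ (Fin (m + n)) λ v → Spans P (inX a) v × InY v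
  xyEnd-spans P a∈ with shape P
  xyEnd-spans P (here refl) | XY a c sP = inY c , sP , c , refl

  xxEnds-unique : ∀ P → Unique (xxEnds P)
  xxEnds-unique P with shape P
  ... | XX a b sP = ((λ { refl → Spans.u≢v sP refl }) ∷ []) ∷ [] ∷ []
  ... | YY _ _ _  = []
  ... | XY _ _ _  = []

  yyEnds-unique : ∀ P → Unique (yyEnds P)
  yyEnds-unique P with shape P
  ... | XX _ _ _  = []
  ... | YY c d sP = ((λ { refl → Spans.u≢v sP refl }) ∷ []) ∷ [] ∷ []
  ... | XY _ _ _  = []

  xyEnd-unique : ∀ P → Unique (xyEnd P)
  xyEnd-unique P with shape P
  ... | XX _ _ _ = []
  ... | YY _ _ _ = []
  ... | XY _ _ _ = [] ∷ []

  count : (Pair → ℕ) → List Pair → ℕ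
  count f J = sum (map f J)

  length-by-shape : ∀ J → length J ≡ count #XX J + count #YY J + length (concatMap xyEnd J)
  length-by-shape [] = refl
  length-by-shape (P ∷ J) = begin
    suc (length J)                    ≡⟨ cong₂ _+_ (one P) (length-by-shape J) ⟩
    (p + q + r) + (#xx + #yy + #xy)   ≡⟨ regroup p q r #xx #yy #xy ⟩
    (p + #xx) + (q + #yy) + (r + #xy) ≡⟨ cong (p + #xx + (q + #yy) +_) (length-++ (xyEnd P)) ⟨
    count #XX (P ∷ J) + count #YY (P ∷ J) + length (concatMap xyEnd (P ∷ J)) ∎
    where
    open ≡-Reasoning
    p q r #xx #yy #xy : ℕ
    p = #XX P
    q = #YY P
    r = length (xyEnd P)
    #xx = count #XX J
    #yy = count #YY J
    #xy = length (concatMap xyEnd J)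
    one : ∀ P → 1 ≡ #XX P + #YY P + length (xyEnd P)
    one P with shape P
    ... | XX _ _ _ = refl
    ... | YY _ _ _ = refl
    ... | XY _ _ _ = refl
    regroup : ∀ a b c a′ b′ c′ → (a + b + c) + (a′ + b′ + c′) ≡ (a + a′) + (b + b′) + (c + c′)
    regroup = solve-∀

  length-xxEnds : ∀ J → length (concatMap xxEnds J) ≡ count #XX J + count #XX J
  length-xxEnds = length-concatMap-double xxEnds #XX λ P → two P
    where
    two : ∀ P → length (xxEnds P) ≡ #XX P + #XX P
    two P with shape P
    ... | XX _ _ _ = refl
    ... | YY _ _ _ = refl
    ... | XY _ _ _ = refl

  length-yyEnds : ∀ J → length (concatMap yyEnds J) ≡ count #YY J + count #YY J
  length-yyEnds = length-concatMap-double yyEnds #YY λ P → two P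
    where
    two : ∀ P → length (yyEnds P) ≡ #YY P + #YY P
    two P with shape P
    ... | XX _ _ _ = refl
    ... | YY _ _ _ = refl
    ... | XY _ _ _ = refl

  independent-size-bound : ∀ {J} → IndependentSet (T2 G) J → 2 + length (concatMap xxEnds J) ≤ m →
                           suc (length J) ≤ m + ⌊ m /2⌋ + ⌊ n /2⌋
  independent-size-bound {J} indJ two-X-vertices-unpaired = begin
    suc (length J)                                     ≡⟨ cong suc (length-by-shape J) ⟩
    suc (#xx + #yy + length (concatMap xyEnd J))       ≡⟨ regroup #xx #yy (length (concatMap xyEnd J)) ⟩
    length (concatMap xyEnd J) + suc #xx + #yy         ≤⟨ +-mono-≤ (+-mono-≤ xy-bound xx-bound) yy-bound ⟩
    m + ⌊ m /2⌋ + ⌊ n /2⌋                              ∎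
    where
    open ≤-Reasoning
    #xx #yy : ℕ
    #xx = count #XX J
    #yy = count #YY J
    regroup : ∀ a b c → suc (a + b + c) ≡ c + suc a + b
    regroup = solve-∀
    xy-bound : length (concatMap xyEnd J) ≤ m
    xy-bound = Unique⇒length≤ (Unique-concatMap-ends xyEnd inX InY InY-clique xyEnd-spans xyEnd-unique indJ)
    xx-bound : suc #xx ≤ ⌊ m /2⌋
    xx-bound = double≤⇒≤⌊/2⌋ (begin
      suc #xx + suc #xx                ≡⟨ cong suc (+-suc #xx #xx) ⟩
      2 + (#xx + #xx)                  ≡⟨ cong (2 +_) (length-xxEnds J) ⟨
      2 + length (concatMap xxEnds J)  ≤⟨ two-X-vertices-unpaired ⟩
      m                                ∎)
    yy-bound : #yy ≤ ⌊ n /2⌋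
    yy-bound = double≤⇒≤⌊/2⌋ (subst (_≤ n) (length-yyEnds J)
      (Unique⇒length≤ (Unique-concatMap-ends yyEnds inY InY InY-clique yyEnds-spans yyEnds-unique indJ)))

  xx : (a b : Fin m) → a ≢ b → Pair
  xx a b a≢b = pair (inX a) (inX b) (inX≢ a≢b)

  xy : Fin m → Fin n → Pair
  xy a c = pair (inX a) (inY c) inX≢inY

  yy : (c d : Fin n) → c ≢ d → Pair
  yy c d c≢d = pair (inY c) (inY d) (inY≢ c≢d)

  xx-spans : ∀ {a b} (a≢b : a ≢ b) → Spans (xx a b a≢b) (inX a) (inX b)
  xx-spans _ = pair-spans _

  xy-spans : ∀ a c → Spans (xy a c) (inX a) (inY c)
  xy-spans _ _ = pair-spans inX≢inY

  yy-spans : ∀ {c d} (c≢d : c ≢ d) → Spans (yy c d c≢d) (inY c) (inY d)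
  yy-spans _ = pair-spans _

  block : (a b : Fin m) (c d : Fin n) → a ≢ b → c ≢ d → List Pair
  block a b c d a≢b c≢d = xx a b a≢b ∷ xy a c ∷ xy b d ∷ yy c d c≢d ∷ []

  block-all : ∀ {a b c d} a≢b c≢d (Q : Fin (m + n) → Set) → Q (inX a) → Q (inX b) → Q (inY c) → Q (inY d) →
              ∀ {P} → P ∈ block a b c d a≢b c≢d → ∀ {v} → v ∈₂ P → Q v
  block-all a≢b c≢d Q Qa Qb Qc Qd (here refl)                         = Spans-all Q (xx-spans a≢b) Qa Qb
  block-all a≢b c≢d Q Qa Qb Qc Qd (there (here refl))                 = Spans-all Q (xy-spans _ _) Qa Qc
  block-all a≢b c≢d Q Qa Qb Qc Qd (there (there (here refl)))         = Spans-all Q (xy-spans _ _) Qb Qd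
  block-all a≢b c≢d Q Qa Qb Qc Qd (there (there (there (here refl)))) = Spans-all Q (yy-spans c≢d) Qc Qd

  block-independent : ∀ {a b c d} (a≢b : a ≢ b) (c≢d : c ≢ d) → Isolated c → Isolated d →
                      IndependentSet (T2 G) (block a b c d a≢b c≢d)
  block-independent {a} {b} {c} {d} a≢b c≢d c-isolated d-isolated =
    IndependentSet-∷ (IndependentSet-∷ (IndependentSet-∷ (IndependentSet-∷ IndependentSet-[] λ ())
      λ { (here refl) → meeting-compatible (Spans-sym sbd) (Spans-sym scd) inX≢inY c≁ })
      λ { (here refl) →
            Disjoint⇒Compatible (Spans-disjoint sac sbd (inX≢ a≢b) inX≢inY (inX≢inY ∘ sym) (inY≢ c≢d))
        ; (there (here refl)) → meeting-compatible (Spans-sym sac) scd inX≢inY d≁ })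
      λ { (here refl) → meeting-compatible sab sac inX≢inY c≁
        ; (there (here refl)) → meeting-compatible (Spans-sym sab) sbd inX≢inY d≁
        ; (there (there (here refl))) →
            Disjoint⇒Compatible (Spans-disjoint sab scd inX≢inY inX≢inY inX≢inY inX≢inY) }
    where
    sab : Spans (xx a b a≢b) (inX a) (inX b)
    sab = xx-spans a≢b
    sac : Spans (xy a c) (inX a) (inY c)
    sac = xy-spans a c
    sbd : Spans (xy b d) (inX b) (inY d)
    sbd = xy-spans b d
    scd : Spans (yy c d c≢d) (inY c) (inY d)
    scd = yy-spans c≢d
    c≁ : ∀ {a′} → ¬ G (inX a′) (inY c)
    c≁ = isolated-nonadjacent c-isolated
    d≁ : ∀ {a′} → ¬ G (inX a′) (inY d)
    d≁ = isolated-nonadjacent d-isolated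

  ladder : (xs : List (Fin m)) (ys : List (Fin n)) → Unique xs → Unique ys → List Pair
  ladder [] ys _ uys = pairUp (map inY ys) (Unique.map⁺ inY-injective uys)
  ladder (a ∷ []) ys@(c ∷ d ∷ _) uxs uys = xy a d ∷ ladder [] ys [] uys
  ladder (a ∷ b ∷ xs) (c ∷ d ∷ ys) ((a≢b ∷ _) ∷ _ ∷ uxs) ((c≢d ∷ _) ∷ _ ∷ uys) =
    block a b c d a≢b c≢d ++ ladder xs ys uxs uys
  ladder _ _ _ _ = []

  Fits : List (Fin m) → List (Fin n) → Set
  Fits []           _            = ⊤
  Fits (_ ∷ [])     (c ∷ _ ∷ _)  = Isolated c
  Fits (_ ∷ _ ∷ xs) (c ∷ d ∷ ys) = Isolated c × Isolated d × Fits xs ys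
  Fits _            _            = ⊥

  Among : List (Fin m) → List (Fin n) → Fin (m + n) → Set
  Among xs ys v = v ∈ map inX xs ⊎ v ∈ map inY ys

  ladder-⊆ : ∀ xs ys uxs uys {P v} → P ∈ ladder xs ys uxs uys → v ∈₂ P → Among xs ys v
  ladder-⊆ [] ys _ uys P∈ v∈P = inj₂ (pairUp-⊆ (map inY ys) _ P∈ v∈P)
  ladder-⊆ (a ∷ []) ys@(c ∷ d ∷ _) _ _ (here refl) =
    Spans-all (Among (a ∷ []) ys) (xy-spans a d) (inj₁ (here refl)) (inj₂ (there (here refl)))
  ladder-⊆ (a ∷ []) ys@(_ ∷ _ ∷ _) _ uys (there P∈) v∈P = inj₂ (pairUp-⊆ (map inY ys) _ P∈ v∈P)
  ladder-⊆ (a ∷ b ∷ xs) (c ∷ d ∷ ys) ((a≢b ∷ _) ∷ _ ∷ uxs) ((c≢d ∷ _) ∷ _ ∷ uys) P∈ v∈P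
    with ∈-++⁻ (block a b c d a≢b c≢d) P∈
  ... | inj₁ P∈block =
    block-all {a} {b} {c} {d} a≢b c≢d (Among (a ∷ b ∷ xs) (c ∷ d ∷ ys))
              (inj₁ (here refl)) (inj₁ (there (here refl))) (inj₂ (here refl)) (inj₂ (there (here refl)))
              P∈block v∈P
  ... | inj₂ P∈ladder with ladder-⊆ xs ys uxs uys P∈ladder v∈P
  ...   | inj₁ v∈xs = inj₁ (there (there v∈xs))
  ...   | inj₂ v∈ys = inj₂ (there (there v∈ys))

  inX∉Among : ∀ {a xs ys} → All (a ≢_) xs → ¬ Among xs ys (inX a)
  inX∉Among a∉xs (inj₁ a∈) with _ , a′∈xs , e ← ∈-map⁻ inX a∈ = All.lookup a∉xs a′∈xs (inX-injective e)
  inX∉Among a∉xs (inj₂ a∈) with _ , _ , e ← ∈-map⁻ inY a∈ = inX≢inY e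

  inY∉Among : ∀ {c xs ys} → All (c ≢_) ys → ¬ Among xs ys (inY c)
  inY∉Among c∉ys (inj₁ c∈) with _ , _ , e ← ∈-map⁻ inX c∈ = inX≢inY (sym e)
  inY∉Among c∉ys (inj₂ c∈) with _ , c′∈ys , e ← ∈-map⁻ inY c∈ = All.lookup c∉ys c′∈ys (inY-injective e)

  ladder-independent : ∀ xs ys uxs uys → Fits xs ys → IndependentSet (T2 G) (ladder xs ys uxs uys)
  ladder-independent [] ys _ uys _ = pairUp-independent (map inY ys) _
  ladder-independent (a ∷ []) ys@(c ∷ d ∷ ys′) _ uys@((c≢d ∷ _) ∷ d∉ys′ ∷ _) c-isolated =
    IndependentSet-∷ (ladder-independent [] ys [] uys tt) λ where
      (here refl) → meeting-compatible (Spans-sym (xy-spans a d)) (Spans-sym (yy-spans c≢d))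
                                       inX≢inY (isolated-nonadjacent c-isolated)
      (there Q∈)  → Disjoint⇒Compatible λ v v∈P v∈Q →
        Spans-all (¬_ ∘ Among [] ys′) (xy-spans a d) (inX∉Among []) (inY∉Among d∉ys′) v∈P
                  (inj₂ (pairUp-⊆ (map inY ys′) _ Q∈ v∈Q))
  ladder-independent (a ∷ b ∷ xs) (c ∷ d ∷ ys) ((a≢b ∷ a∉xs) ∷ b∉xs ∷ uxs) ((c≢d ∷ c∉ys) ∷ d∉ys ∷ uys)
                     (c-isolated , d-isolated , fits) =
    IndependentSet-++ (block-independent a≢b c≢d c-isolated d-isolated)
                      (ladder-independent xs ys uxs uys fits) λ P∈ Q∈ v v∈P v∈Q →
        block-all {a} {b} {c} {d} a≢b c≢d (¬_ ∘ Among xs ys)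
                  (inX∉Among a∉xs) (inX∉Among b∉xs) (inY∉Among c∉ys) (inY∉Among d∉ys) P∈ v∈P
                  (ladder-⊆ xs ys uxs uys Q∈ v∈Q)

  length-ladder : ∀ xs ys uxs uys → Fits xs ys →
                  length (ladder xs ys uxs uys) ≡ length xs + ⌊ length xs /2⌋ + ⌊ length ys /2⌋
  length-ladder [] ys _ uys _ = trans (length-pairUp (map inY ys) _) (cong ⌊_/2⌋ (length-map inY ys))
  length-ladder (a ∷ []) ys@(_ ∷ _ ∷ _) _ uys _ = cong suc (length-ladder [] ys [] uys tt)
  length-ladder (a ∷ b ∷ xs) (c ∷ d ∷ ys) ((_ ∷ _) ∷ _ ∷ uxs) ((_ ∷ _) ∷ _ ∷ uys) (_ , _ , fits) =
    trans (cong (4 +_) (length-ladder xs ys uxs uys fits))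
          (regroup (length xs) ⌊ length xs /2⌋ ⌊ length ys /2⌋)
    where
    regroup : ∀ p q r → 4 + (p + q + r) ≡ suc (suc p) + suc q + suc r
    regroup = solve-∀

  Fits-++ : ∀ xs zs ws → length xs ≤ length zs → All Isolated zs → length xs < length (zs ++ ws) →
            Fits xs (zs ++ ws)
  Fits-++ [] _ _ _ _ _ = tt
  Fits-++ (_ ∷ []) (c ∷ zs) ws _ (c-isolated ∷ _) 1<len with zs ++ ws | 1<len
  ... | []    | s≤s ()
  ... | _ ∷ _ | _ = c-isolated
  Fits-++ (_ ∷ _ ∷ xs) (c ∷ d ∷ zs) ws (s≤s (s≤s xs≤zs)) (c-isolated ∷ d-isolated ∷ zs-isolated)
          (s≤s (s≤s xs<zs++ws)) =
    c-isolated , d-isolated , Fits-++ xs zs ws xs≤zs zs-isolated xs<zs++ws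
  Fits-++ (_ ∷ _ ∷ _) (_ ∷ []) _ (s≤s ()) _ _

  hasXNeighbour : Fin n → Bool
  hasXNeighbour c = any (λ a → E a c) (allFin m)

  isolatedY nonIsolatedY : List (Fin n)
  isolatedY    = filterᵇ (not ∘ hasXNeighbour) (allFin n)
  nonIsolatedY = filterᵇ hasXNeighbour (allFin n)

  isolatedY⇒¬hasXNeighbour : ∀ {c} → c ∈ isolatedY → hasXNeighbour c ≡ false
  isolatedY⇒¬hasXNeighbour c∈ =
    Equivalence.to T-not-≡ (proj₂ (∈-filter⁻ (T? ∘ not ∘ hasXNeighbour) {xs = allFin n} c∈))

  isolatedY-isolated : All Isolated isolatedY
  isolatedY-isolated = All.tabulate λ {c} c∈ a → ¬-not λ Eac≡true →
    subst T (isolatedY⇒¬hasXNeighbour c∈)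
      (any⁺ (λ a → E a c) (Any.map (λ { refl → Equivalence.from T-≡ Eac≡true }) (∈-allFin a)))

  isolatedY++nonIsolatedY-unique : Unique (isolatedY ++ nonIsolatedY)
  isolatedY++nonIsolatedY-unique =
    Unique.++⁺ (Unique.filter⁺ (T? ∘ not ∘ hasXNeighbour) (Unique.allFin⁺ n))
               (Unique.filter⁺ (T? ∘ hasXNeighbour) (Unique.allFin⁺ n))
               λ (c∈iso , c∈non) → subst T (isolatedY⇒¬hasXNeighbour c∈iso)
                                           (proj₂ (∈-filter⁻ (T? ∘ hasXNeighbour) {xs = allFin n} c∈non))

  large-independent-set : m < n → numYWithXNbr m n E ≤ n ∸ m →
    Σ (List Pair) λ B → IndependentSet (T2 G) B × length B ≡ m + ⌊ m /2⌋ + ⌊ n /2⌋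
  large-independent-set m<n few-non-isolated =
    ladder (allFin m) ys (Unique.allFin⁺ m) isolatedY++nonIsolatedY-unique ,
    ladder-independent _ _ _ _ fits ,
    trans (length-ladder _ _ _ _ fits) (cong₂ (λ p q → p + ⌊ p /2⌋ + ⌊ q /2⌋) (length-allFin m) length-ys)
    where
    ys : List (Fin n)
    ys = isolatedY ++ nonIsolatedY
    partition : length isolatedY + length nonIsolatedY ≡ n
    partition = trans (length-filterᵇ-partition hasXNeighbour (allFin n)) (length-allFin n)
    length-ys : length ys ≡ n
    length-ys = trans (length-++ isolatedY) partition
    m≤#isolated : m ≤ length isolatedY
    m≤#isolated = +-cancelʳ-≤ (length nonIsolatedY) m (length isolatedY) (begin
      m + length nonIsolatedY                ≤⟨ +-monoʳ-≤ m few-non-isolated ⟩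
      m + (n ∸ m)                            ≡⟨ m+[n∸m]≡n (<⇒≤ m<n) ⟩
      n                                      ≡⟨ sym partition ⟩
      length isolatedY + length nonIsolatedY ∎)
      where open ≤-Reasoning
    fits : Fits (allFin m) ys
    fits = Fits-++ (allFin m) isolatedY nonIsolatedY
                   (subst (_≤ length isolatedY) (sym (length-allFin m)) m≤#isolated) isolatedY-isolated
                   (subst₂ _<_ (sym (length-allFin m)) (sym length-ys) m<n)

module Triangle (k l : ℕ) (E : Fin (3 + k) → Fin (3 + l) → Bool) where

  open ClassG (3 + k) (3 + l) E

  corner : Fin 3 → Fin (3 + k)
  corner i = i ↑ˡ k

  other : Fin k → Fin (3 + k)
  other j = 3 ↑ʳ j

  data CornerView : Fin (3 + k) → Set where
    is-corner : ∀ i → CornerView (corner i)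
    is-other  : ∀ j → CornerView (other j)

  cornerView : ∀ a → CornerView a
  cornerView 0F                  = is-corner 0F
  cornerView 1F                  = is-corner 1F
  cornerView 2F                  = is-corner 2F
  cornerView (suc (suc (suc j))) = is-other j

  corner≢other : ∀ i j → corner i ≢ other j
  corner≢other 0F _ ()
  corner≢other 1F _ ()
  corner≢other 2F _ ()

  x₁ x₂ x₃ : Fin (3 + k)
  x₁ = 0F
  x₂ = 1F
  x₃ = 2F

  y₁ y₂ y₃ : Fin (3 + l)
  y₁ = 0F
  y₂ = 1F
  y₃ = 2F

  triangle : List Pair
  triangle = xy x₁ y₂ ∷ xy x₂ y₃ ∷ xy x₃ y₁ ∷ []

  rest : List (Fin (3 + k + (3 + l)))
  rest = map (inX ∘ other) (allFin k)

  ∈-rest : ∀ j → inX (other j) ∈ rest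
  ∈-rest j = ∈-map⁺ (inX ∘ other) (∈-allFin j)

  rest-unique : Unique rest
  rest-unique = Unique.map⁺ (λ e → ↑ʳ-injective 3 _ _ (inX-injective e)) (Unique.allFin⁺ k)

  corner∉rest : ∀ i → inX (corner i) ∉ rest
  corner∉rest i v∈ with j , _ , e ← ∈-map⁻ (inX ∘ other) v∈ = corner≢other i j (inX-injective e)

  inY∉rest : ∀ c → inY c ∉ rest
  inY∉rest c v∈ with _ , _ , e ← ∈-map⁻ (inX ∘ other) v∈ = inX≢inY (sym e)

  seed : List Pair
  seed = triangle ++ pairUp rest rest-unique

  seed-independent : IndependentSet (T2 G) seed
  seed-independent =
    IndependentSet-++ triangle-independent (pairUp-independent rest rest-unique) separated
    where
    disjoint : ∀ a b c d → a ≢ b → c ≢ d → Disjoint (xy a c) (xy b d)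
    disjoint a b c d a≢b c≢d =
      Spans-disjoint (xy-spans a c) (xy-spans b d) (inX≢ a≢b) inX≢inY (inX≢inY ∘ sym) (inY≢ c≢d)
    triangle-independent : IndependentSet (T2 G) triangle
    triangle-independent =
      IndependentSet-∷ (IndependentSet-∷ (IndependentSet-∷ IndependentSet-[] λ ())
        λ { (here refl) → Disjoint⇒Compatible (disjoint x₂ x₃ y₃ y₁ (λ ()) λ ()) })
        λ { (here refl) → Disjoint⇒Compatible (disjoint x₁ x₂ y₂ y₃ (λ ()) λ ())
          ; (there (here refl)) → Disjoint⇒Compatible (disjoint x₁ x₃ y₂ y₁ (λ ()) λ ()) }
    off-rest : ∀ {P} → P ∈ triangle → ∀ {v} → v ∈₂ P → v ∉ rest
    off-rest (here refl)                 = Spans-all (_∉ rest) (xy-spans x₁ y₂) (corner∉rest 0F) (inY∉rest y₂)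
    off-rest (there (here refl))         = Spans-all (_∉ rest) (xy-spans x₂ y₃) (corner∉rest 1F) (inY∉rest y₃)
    off-rest (there (there (here refl))) = Spans-all (_∉ rest) (xy-spans x₃ y₁) (corner∉rest 2F) (inY∉rest y₁)
    separated : ∀ {P Q} → P ∈ triangle → Q ∈ pairUp rest rest-unique → Disjoint P Q
    separated P∈ Q∈ v v∈P v∈Q = off-rest P∈ v∈P (pairUp-⊆ rest rest-unique Q∈ v∈Q)

  module _ (e₁ : E x₁ y₁ ≡ true) (e₂ : E x₂ y₂ ≡ true) (e₃ : E x₃ y₃ ≡ true)
           {J : List Pair} (indJ : IndependentSet (T2 G) J) (seed⊆J : seed ⊆ J) where

    private
      iJ : Independent (T2 G) J
      iJ = proj₂ indJ

      blocked : ∀ {P a b c} → P ∈ J → Spans P (inX a) (inX b) → xy a c ∈ J → E b c ≡ true → ⊥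
      blocked P∈ sP Q∈ e = meeting-nonadjacent iJ P∈ Q∈ sP (xy-spans _ _) (XY-edge e)

    corners-not-paired : ∀ {P} i j → P ∈ J → ¬ Spans P (inX (corner i)) (inX (corner j))
    corners-not-paired 0F 0F P∈ sP = Spans.u≢v sP refl
    corners-not-paired 1F 1F P∈ sP = Spans.u≢v sP refl
    corners-not-paired 2F 2F P∈ sP = Spans.u≢v sP refl
    corners-not-paired 0F 1F P∈ sP = blocked P∈ sP (seed⊆J (here refl)) e₂
    corners-not-paired 1F 2F P∈ sP = blocked P∈ sP (seed⊆J (there (here refl))) e₃
    corners-not-paired 2F 0F P∈ sP = blocked P∈ sP (seed⊆J (there (there (here refl)))) e₁
    corners-not-paired 1F 0F P∈ sP = corners-not-paired 0F 1F P∈ (Spans-sym sP)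
    corners-not-paired 2F 1F P∈ sP = corners-not-paired 1F 2F P∈ (Spans-sym sP)
    corners-not-paired 0F 2F P∈ sP = corners-not-paired 2F 0F P∈ (Spans-sym sP)

    -- A matched vertex of rest already lies in a pair of seed together with another X-vertex.
    partner-unmatched : ∀ {P} i j → P ∈ J → Spans P (inX (corner i)) (inX (other j)) →
                        ¬ MatchedIn rest rest-unique (inX (other j))
    partner-unmatched i j P∈ sP (Q , Q∈ , w , w∈ , sQ) with j′ , _ , refl ← ∈-map⁻ (inX ∘ other) w∈ =
      meeting-nonadjacent iJ P∈ (seed⊆J (∈-++⁺ʳ triangle Q∈)) (Spans-sym sP) sQ
        (X-clique (corner≢other i j′))

    corner-partner : ∀ i → corner i ∈ concatMap xxEnds J →
      Σ (Fin k) λ j → ¬ MatchedIn rest rest-unique (inX (other j)) ×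
                      Σ Pair λ P → P ∈ J × Spans P (inX (corner i)) (inX (other j))
    corner-partner i i∈ with P , P∈ , i∈P ← find (∈-concatMap⁻ xxEnds i∈)
                       with _ , sP , b , refl ← xxEnds-spans P i∈P
                       with cornerView b
    ... | is-corner i′ = ⊥-elim (corners-not-paired i i′ P∈ sP)
    ... | is-other j   = j , partner-unmatched i j P∈ sP , P , P∈ , sP

    at-most-one-corner : ∀ {i i′} → i ≢ i′ →
                         corner i ∈ concatMap xxEnds J → corner i′ ∈ concatMap xxEnds J → ⊥
    at-most-one-corner {i} {i′} i≢i′ i∈ i′∈
      with j , j-unmatched , P , P∈ , sP ← corner-partner i i∈
         | j′ , j′-unmatched , P′ , P′∈ , sP′ ← corner-partner i′ i′∈
         | j ≟ᶠ j′
    ... | yes refl = meeting-nonadjacent iJ P∈ P′∈ (Spans-sym sP) (Spans-sym sP′)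
                       (X-clique λ e → i≢i′ (↑ˡ-injective k i i′ e))
    ... | no j≢j′ with pairUp-matches rest rest-unique (∈-rest j) (∈-rest j′)
                         (inX≢ λ e → j≢j′ (↑ʳ-injective 3 j j′ e))
    ...   | inj₁ matched = j-unmatched matched
    ...   | inj₂ matched = j′-unmatched matched

    2+length-xxEnds≤ : 2 + length (concatMap xxEnds J) ≤ 3 + k
    2+length-xxEnds≤ = at-most-one-of-three⇒2+length≤
      (Unique-concatMap-ends xxEnds inX InX InX-clique xxEnds-spans xxEnds-unique indJ)
      {corner 0F} {corner 1F} {corner 2F} (λ ()) (λ ()) (λ ())
      (at-most-one-corner (λ ())) (at-most-one-corner (λ ())) (at-most-one-corner (λ ()))

theorem6p8 : (k l : ℕ) (E : Fin (3 + k) → Fin (3 + l) → Bool) →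
    (3 + k) + 3 ≤ 3 + l →
    E zero zero ≡ true →
    E (suc zero) (suc zero) ≡ true →
    E (suc (suc zero)) (suc (suc zero)) ≡ true →
    numYWithXNbr (3 + k) (3 + l) E ≤ (3 + l) ∸ (3 + k) →
    ¬ WellCovered (T2 (GAdj (3 + k) (3 + l) E))
theorem6p8 k l E m+3≤n e₁ e₂ e₃ few-non-isolated =
  let B , indB , |B| = large-independent-set m<n few-non-isolated in
  smallExtensions⇒¬WellCovered-T2 G? seed-independent indB λ {J} indJ seed⊆J →
    subst (suc (length J) ≤_) (sym |B|) (independent-size-bound indJ (2+length-xxEnds≤ e₁ e₂ e₃ indJ seed⊆J))
  where
  open ClassG (3 + k) (3 + l) E
  open Triangle k l E
  m<n : 3 + k < 3 + l
  m<n = <-≤-trans (m<m+n (3 + k) (s≤s z≤n)) m+3≤n
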